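{- Let $L$ be a Latin square of order $n \geq 2$. Any partial transversal $T$ of $L$ of deficit $d$ is contained in an $(n+\lceil d/2 \rceil)$-cover. Moreover, if $T$ is maximal, then the smallest cover of $L$ containing $T$ has size $n+\lceil d/2 \rceil$.
   Context: A Latin square of order $n$ is an $n\times n$ array on $n$ symbols in which each symbol occurs once in each row and each column; its set of entries is $E(L)=\{(i,j,L_{ij})\}$. A line is the set of all entries in a given row, in a given column, or with a given symbol. A cover is a subset of $E(L)$ meeting every line; a $c$-cover is a cover of size $c$. A partial transversal of deficit $d$ is an $(n-d)$-subset of $E(L)$ in which every line is represented at most once; it is maximal if for every $\mathbf{e}\in E(L)\setminus T$, $T\cup\{\mathbf{e}\}$ is not a partial transversal. -}

module Defs where

open import Data.Nat using (ℕ)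
open import Data.Fin using (Fin)
open import Data.Product using (_×_; _,_; Σ; ∃; ∃-syntax; proj₁; proj₂)
open import Data.List using (List; _∷_)
open import Data.List.Membership.Propositional using (_∈_; _∉_)
open import Data.List.Relation.Unary.Unique.Propositional using (Unique)
open import Relation.Binary.PropositionalEquality using (_≡_)
open import Relation.Nullary using (¬_)

IsLatinSquare : (n : ℕ) → (Fin n → Fin n → Fin n) → Set
IsLatinSquare n L =
  (∀ (i s : Fin n) → Σ (Fin n) λ j → L i j ≡ s × (∀ j' → L i j' ≡ s → j' ≡ j)) ×
  (∀ (j s : Fin n) → Σ (Fin n) λ i → L i j ≡ s × (∀ i' → L i' j ≡ s → i' ≡ i))

-- An entry (i, j, L i j) of E(L) is determined by its cell (i, j);
-- we represent it by the cell.  A subset of E(L) is a duplicate-free list of cells,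
-- and its size is the length of the list.
Cell : ℕ → Set
Cell n = Fin n × Fin n

row : ∀ {n} → Cell n → Fin n
row = proj₁

col : ∀ {n} → Cell n → Fin n
col = proj₂

sym : ∀ {n} → (Fin n → Fin n → Fin n) → Cell n → Fin n
sym L (i , j) = L i j

IsCover : ∀ {n} → (Fin n → Fin n → Fin n) → List (Cell n) → Set
IsCover {n} L S =
  Unique S ×
  (∀ (r : Fin n) → ∃[ e ] (e ∈ S × row e ≡ r)) ×
  (∀ (c : Fin n) → ∃[ e ] (e ∈ S × col e ≡ c)) ×
  (∀ (s : Fin n) → ∃[ e ] (e ∈ S × sym L e ≡ s))

IsPartialTransversal : ∀ {n} → (Fin n → Fin n → Fin n) → List (Cell n) → Set
IsPartialTransversal {n} L T =
  Unique T ×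
  (∀ e e' → e ∈ T → e' ∈ T → row e ≡ row e' → e ≡ e') ×
  (∀ e e' → e ∈ T → e' ∈ T → col e ≡ col e' → e ≡ e') ×
  (∀ e e' → e ∈ T → e' ∈ T → sym L e ≡ sym L e' → e ≡ e')

IsMaximalPT : ∀ {n} → (Fin n → Fin n → Fin n) → List (Cell n) → Set
IsMaximalPT {n} L T =
  IsPartialTransversal L T ×
  (∀ (e : Cell n) → e ∉ T → ¬ IsPartialTransversal L (e ∷ T))

_⊆_ : ∀ {n} → List (Cell n) → List (Cell n) → Set
T ⊆ C = ∀ e → e ∈ T → e ∈ C

module Submission where

-- Let T be a partial transversal of deficit d, so that exactly d rows, d columns
-- and d symbols are missed by T, and put h = ⌈d/2⌉, f = ⌊d/2⌋.
--
-- Pair the first h missing rows with the first h missing columns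
-- (one cell each), the other f missing rows with the first f missing symbols, and
-- the other f missing columns with the last h missing symbols (the Latin property
-- supplies a cell of any prescribed row/column and symbol).  These at most
-- h + f + h = d + h cells together with T meet every line; after removing
-- duplicates and adding arbitrary further cells we get a cover of size n + h.
--
-- If T is maximal, no cell outside T lies on three missing lines.
-- In a cover C ⊇ T the 3d missing lines are met by the cells X = C ∖ T, each of
-- which meets at most two of them, so 3d ≤ 2|X|, i.e. |X| ≥ d + h and
-- |C| ≥ |T| + |X| ≥ n + h.

open import Defs
open import Data.Nat using (ℕ; zero; suc; _+_; _*_; _∸_; _≤_; _<_; z≤n; s≤s; ⌈_/2⌉; ⌊_/2⌋)
open import Data.Nat.Properties
open import Data.Nat.Solver using (module +-*-Solver)
open import Data.Fin using (Fin)
import Data.Fin.Properties as Fin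
open import Data.Product using (_×_; _,_; ∃-syntax; proj₁; proj₂)
open import Data.Product.Properties using (≡-dec)
open import Data.Sum using (_⊎_; inj₁; inj₂; [_,_]′)
open import Data.List using (List; []; _∷_; length; map; filter; _++_; take; drop; allFin; cartesianProduct; deduplicate)
open import Data.List.Properties using (length-++; length-map; length-tabulate; length-take; length-drop; take++drop≡id; length-deduplicate; filter-notAll)
open import Data.List.Membership.Propositional using (_∈_; _∉_; find; lose)
open import Data.List.Membership.Propositional.Properties using (∈-filter⁺; ∈-filter⁻; ∈-++⁺ˡ; ∈-++⁺ʳ; ∈-++⁻; ∈-map⁺; ∈-map⁻; ∈-allFin; ∈-deduplicate⁺)
open import Data.List.Relation.Unary.Any as Any using (Any; here; there; any?)
import Data.List.Relation.Unary.All as All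
import Data.List.Relation.Unary.All.Properties as All
open import Data.List.Relation.Unary.AllPairs using ([]; _∷_)
open import Data.List.Relation.Unary.Unique.Propositional using (Unique)
import Data.List.Relation.Unary.Unique.Propositional.Properties as Unique
import Data.List.Relation.Unary.Unique.DecPropositional.Properties as DecUnique
open import Relation.Binary.PropositionalEquality using (_≡_; refl; subst; subst₂; cong; cong₂; trans; module ≡-Reasoning) renaming (sym to ≡-sym)
open import Relation.Binary.Definitions using (DecidableEquality)
open import Relation.Nullary using (¬_; Dec; yes; no; ¬?; contradiction)
open import Relation.Nullary.Decidable using (decidable-stable)
open import Relation.Unary using (Pred; Decidable)
open import Data.Empty using (⊥-elim)

ceil-twice : ∀ d → ⌈ d /2⌉ + ⌈ d /2⌉ ≤ suc d
ceil-twice zero = z≤n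
ceil-twice (suc zero) = ≤-refl
ceil-twice (suc (suc d)) rewrite +-suc ⌈ d /2⌉ ⌈ d /2⌉ = s≤s (s≤s (ceil-twice d))

halve : ∀ a x → a + a ≤ suc (x + x) → a ≤ x
halve zero x _ = z≤n
halve (suc a) zero (s≤s le) rewrite +-suc a a with le
... | ()
halve (suc a) (suc x) (s≤s le) rewrite +-suc a a | +-suc x x = s≤s (halve a x (≤-pred le))

three-halves : ∀ d x → d + d + d ≤ x + x → d + ⌈ d /2⌉ ≤ x
three-halves d x le = halve (d + h) x (begin
    (d + h) + (d + h)  ≡⟨ regroup d h ⟩
    (d + d) + (h + h)  ≤⟨ +-monoʳ-≤ (d + d) (ceil-twice d) ⟩
    (d + d) + suc d    ≡⟨ +-suc (d + d) d ⟩
    suc (d + d + d)    ≤⟨ s≤s le ⟩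
    suc (x + x)        ∎)
  where
    open ≤-Reasoning
    open +-*-Solver
    h = ⌈ d /2⌉
    regroup : ∀ d h → (d + h) + (d + h) ≡ (d + d) + (h + h)
    regroup = solve 2 (λ d h → (d :+ h) :+ (d :+ h) := (d :+ d) :+ (h :+ h)) refl

room : ∀ n k → 2 ≤ n → k ≤ n → n + k ≤ n * n
room (suc zero) k (s≤s ()) _
room (suc (suc m)) k _ k≤n =
  ≤-trans (+-monoʳ-≤ (suc (suc m)) k≤n) (+-monoʳ-≤ (suc (suc m)) (m≤n*m (suc (suc m)) (suc m)))

InjectiveOn : {A B : Set} → (A → B) → List A → Set
InjectiveOn f xs = ∀ x y → x ∈ xs → y ∈ xs → f x ≡ f y → x ≡ y

cons-unique : {A : Set} {x : A} {xs : List A} → x ∉ xs → Unique xs → Unique (x ∷ xs)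
cons-unique x∉xs u = All.tabulate (λ y∈xs x≡y → x∉xs (subst (_∈ _) (≡-sym x≡y) y∈xs)) ∷ u

map-unique : {A B : Set} (f : A → B) (xs : List A) → Unique xs → InjectiveOn f xs → Unique (map f xs)
map-unique f [] _ _ = []
map-unique f (x ∷ xs) (x∉xs ∷ u) inj =
  All.map⁺ (All.tabulate (λ {y} y∈xs fx≡fy → All.lookup x∉xs y∈xs (inj x y (here refl) (there y∈xs) fx≡fy)))
  ∷ map-unique f xs u (λ y z y∈ z∈ → inj y z (there y∈) (there z∈))

injectiveOn-∷ : {A B : Set} (f : A → B) {x : A} {xs : List A} →
  InjectiveOn f xs → ¬ Any (λ y → f y ≡ f x) xs → InjectiveOn f (x ∷ xs)
injectiveOn-∷ f inj new _ _ (here refl) (here refl) _ = refl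
injectiveOn-∷ f inj new _ _ (here refl) (there y∈) fx≡fy = ⊥-elim (new (lose y∈ (≡-sym fx≡fy)))
injectiveOn-∷ f inj new _ _ (there y∈) (here refl) fy≡fx = ⊥-elim (new (lose y∈ fy≡fx))
injectiveOn-∷ f inj new y z (there y∈) (there z∈) eq = inj y z y∈ z∈ eq

module DistinctLists {A : Set} (_≟_ : DecidableEquality A) where
  open import Data.List.Membership.DecPropositional _≟_ using (_∈?_)

  unique-⊆-length : ∀ xs ys → Unique xs → (∀ z → z ∈ xs → z ∈ ys) → length xs ≤ length ys
  unique-⊆-length [] ys _ _ = z≤n
  unique-⊆-length (x ∷ xs) ys (x∉xs ∷ u) xs⊆ys =
    ≤-trans (s≤s (unique-⊆-length xs (filter ≢x? ys) u xs⊆ys∖x)) (filter-notAll ≢x? ys x∈ys)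
    where
      ≢x? = λ y → ¬? (y ≟ x)
      xs⊆ys∖x : ∀ z → z ∈ xs → z ∈ filter ≢x? ys
      xs⊆ys∖x z z∈ = ∈-filter⁺ ≢x? (xs⊆ys z (there z∈)) (λ z≡x → All.lookup x∉xs z∈ (≡-sym z≡x))
      x∈ys : Any (λ y → ¬ ¬ (y ≡ x)) ys
      x∈ys = Any.map (λ x≡y ¬y≡x → ¬y≡x (≡-sym x≡y)) (xs⊆ys x (here refl))

  outside : ∀ U C → Unique U → length C < length U → ∃[ x ] (x ∉ C)
  outside U C u C<U with any? (λ x → ¬? (x ∈? C)) U
  ... | yes found = let (x , _ , x∉C) = find found in x , x∉C
  ... | no none = contradiction (unique-⊆-length U C u U⊆C) (<⇒≱ C<U)
    where
      U⊆C : ∀ x → x ∈ U → x ∈ C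
      U⊆C x x∈U = decidable-stable (x ∈? C) (λ x∉C → none (lose x∈U x∉C))

  enlarge : ∀ U → Unique U → ∀ C → Unique C → ∀ m → length C ≤ m → m ≤ length U →
            ∃[ C' ] (Unique C' × (∀ x → x ∈ C → x ∈ C') × length C' ≡ m)
  enlarge U u C uC m C≤m m≤U =
    let (C' , uC' , C⊆C' , len) = add C uC (m ∸ length C) (subst (_≤ length U) (≡-sym (m+[n∸m]≡n C≤m)) m≤U)
    in C' , uC' , C⊆C' , trans len (m+[n∸m]≡n C≤m)
    where
      add : ∀ C → Unique C → ∀ k → length C + k ≤ length U →
            ∃[ C' ] (Unique C' × (∀ x → x ∈ C → x ∈ C') × length C' ≡ length C + k)
      add C uC zero _ = C , uC , (λ _ x∈ → x∈) , ≡-sym (+-identityʳ (length C))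
      add C uC (suc k) le =
        let (x , x∉C) = outside U C u (≤-trans (s≤s (m≤m+n (length C) k)) grown)
            (C' , uC' , C⊆C' , len) = add (x ∷ C) (cons-unique x∉C uC) k grown
        in C' , uC' , (λ y y∈C → C⊆C' y (there y∈C)) , trans len (≡-sym (+-suc (length C) k))
        where
          grown : suc (length C + k) ≤ length U
          grown = subst (_≤ length U) (+-suc (length C) k) le

indicator : {P : Set} → Dec P → ℕ
indicator (yes _) = 1
indicator (no _) = 0

indicator≤1 : {P : Set} (p : Dec P) → indicator p ≤ 1
indicator≤1 (yes _) = s≤s z≤n
indicator≤1 (no _) = z≤n

indicator-three : {P Q R : Set} (p : Dec P) (q : Dec Q) (r : Dec R) → ¬ (P × Q × R) →
  indicator p + indicator q + indicator r ≤ 2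
indicator-three (yes p) (yes q) (yes r) notAll = ⊥-elim (notAll (p , q , r))
indicator-three (yes _) (yes _) (no _) _ = ≤-refl
indicator-three (yes _) (no _) r _ = s≤s (indicator≤1 r)
indicator-three (no _) q r _ = +-mono-≤ (indicator≤1 q) (indicator≤1 r)

filter-length-∷ : {A : Set} {P : Pred A _} (P? : Decidable P) (x : A) (xs : List A) →
  length (filter P? (x ∷ xs)) ≡ indicator (P? x) + length (filter P? xs)
filter-length-∷ P? x xs with P? x
... | yes _ = refl
... | no _ = refl

count-three : {A : Set} {P Q R : Pred A _} (P? : Decidable P) (Q? : Decidable Q) (R? : Decidable R) →
  ∀ xs → (∀ x → x ∈ xs → ¬ (P x × Q x × R x)) →
  length (filter P? xs) + length (filter Q? xs) + length (filter R? xs) ≤ length xs + length xs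
count-three P? Q? R? [] _ = z≤n
count-three P? Q? R? (x ∷ xs) none = begin
    length (filter P? (x ∷ xs)) + length (filter Q? (x ∷ xs)) + length (filter R? (x ∷ xs))
      ≡⟨ cong₂ _+_ (cong₂ _+_ (filter-length-∷ P? x xs) (filter-length-∷ Q? x xs)) (filter-length-∷ R? x xs) ⟩
    (i + a) + (j + b) + (k + c)
      ≡⟨ regroup i j k a b c ⟩
    (i + j + k) + (a + b + c)
      ≤⟨ +-mono-≤ (indicator-three (P? x) (Q? x) (R? x) (none x (here refl)))
                  (count-three P? Q? R? xs (λ y y∈ → none y (there y∈))) ⟩
    2 + (length xs + length xs)
      ≡⟨ cong suc (≡-sym (+-suc (length xs) (length xs))) ⟩
    suc (length xs) + suc (length xs) ∎
  where
    open ≤-Reasoning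
    open +-*-Solver
    i = indicator (P? x)
    j = indicator (Q? x)
    k = indicator (R? x)
    a = length (filter P? xs)
    b = length (filter Q? xs)
    c = length (filter R? xs)
    regroup : ∀ i j k a b c → (i + a) + (j + b) + (k + c) ≡ (i + j + k) + (a + b + c)
    regroup = solve 6 (λ i j k a b c → (i :+ a) :+ (j :+ b) :+ (k :+ c) := (i :+ j :+ k) :+ (a :+ b :+ c)) refl

module Pairing {A B X : Set} (both : A → B → X) (onlyA : A → X) (onlyB : B → X) where

  zipCover : List A → List B → List X
  zipCover [] bs = map onlyB bs
  zipCover (a ∷ as) [] = onlyA a ∷ zipCover as []
  zipCover (a ∷ as) (b ∷ bs) = both a b ∷ zipCover as bs

  zipCover-length : ∀ as bs k → length as ≤ k → length bs ≤ k → length (zipCover as bs) ≤ k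
  zipCover-length [] bs k _ bs≤k = subst (_≤ k) (≡-sym (length-map onlyB bs)) bs≤k
  zipCover-length (a ∷ as) [] (suc k) (s≤s as≤k) _ = s≤s (zipCover-length as [] k as≤k z≤n)
  zipCover-length (a ∷ as) (b ∷ bs) (suc k) (s≤s as≤k) (s≤s bs≤k) = s≤s (zipCover-length as bs k as≤k bs≤k)

  zipCover-left : (Serves : A → X → Set) → (∀ a b → Serves a (both a b)) → (∀ a → Serves a (onlyA a)) →
    ∀ as bs {a} → a ∈ as → ∃[ x ] (x ∈ zipCover as bs × Serves a x)
  zipCover-left S sb sa (a ∷ as) [] (here refl) = onlyA a , here refl , sa a
  zipCover-left S sb sa (a ∷ as) (b ∷ bs) (here refl) = both a b , here refl , sb a b
  zipCover-left S sb sa (_ ∷ as) [] (there a∈) =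
    let (x , x∈ , s) = zipCover-left S sb sa as [] a∈ in x , there x∈ , s
  zipCover-left S sb sa (_ ∷ as) (_ ∷ bs) (there a∈) =
    let (x , x∈ , s) = zipCover-left S sb sa as bs a∈ in x , there x∈ , s

  zipCover-right : (Serves : B → X → Set) → (∀ a b → Serves b (both a b)) → (∀ b → Serves b (onlyB b)) →
    ∀ as bs {b} → b ∈ bs → ∃[ x ] (x ∈ zipCover as bs × Serves b x)
  zipCover-right S sb sb' [] bs {b} b∈ = onlyB b , ∈-map⁺ onlyB b∈ , sb' b
  zipCover-right S sb sb' (a ∷ as) (b ∷ bs) (here refl) = both a b , here refl , sb a b
  zipCover-right S sb sb' (_ ∷ as) (_ ∷ bs) (there b∈) =
    let (x , x∈ , s) = zipCover-right S sb sb' as bs b∈ in x , there x∈ , s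

complete-length : ∀ {n} (xs : List (Fin n)) → Unique xs → (∀ r → r ∈ xs) → length xs ≡ n
complete-length {n} xs u complete = ≤-antisym
  (subst (length xs ≤_) (length-tabulate {n = n} (λ r → r)) (unique-⊆-length xs (allFin n) u (λ r _ → ∈-allFin r)))
  (subst (_≤ length xs) (length-tabulate {n = n} (λ r → r)) (unique-⊆-length (allFin n) xs (Unique.allFin⁺ n) (λ r _ → complete r)))
  where open DistinctLists Fin._≟_

cartesianProduct-length : {A B : Set} (xs : List A) (ys : List B) → length (cartesianProduct xs ys) ≡ length xs * length ys
cartesianProduct-length [] ys = refl
cartesianProduct-length (x ∷ xs) ys =
  trans (length-++ (map (x ,_) ys)) (cong₂ _+_ (length-map (x ,_) ys) (cartesianProduct-length xs ys))

_≟ᶜ_ : ∀ {n} → DecidableEquality (Cell n)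
_≟ᶜ_ = ≡-dec Fin._≟_ Fin._≟_

allCells : ∀ n → List (Cell n)
allCells n = cartesianProduct (allFin n) (allFin n)

allCells-unique : ∀ n → Unique (allCells n)
allCells-unique n = Unique.cartesianProduct⁺ (Unique.allFin⁺ n) (Unique.allFin⁺ n)

allCells-length : ∀ n → length (allCells n) ≡ n * n
allCells-length n = trans (cartesianProduct-length (allFin n) (allFin n))
  (cong₂ _*_ (length-tabulate {n = n} (λ r → r)) (length-tabulate {n = n} (λ r → r)))

-- A line kind g is row, col or sym L; the line (g, r) consists of the cells e with g e ≡ r.
-- S meets every line of kind g.
MeetsAll : ∀ {n} → List (Cell n) → (Cell n → Fin n) → Set
MeetsAll {n} S g = ∀ (r : Fin n) → ∃[ e ] (e ∈ S × g e ≡ r)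

meets-⊆ : ∀ {n} {S S' : List (Cell n)} {P : Cell n → Set} →
  (∀ e → e ∈ S → e ∈ S') → ∃[ e ] (e ∈ S × P e) → ∃[ e ] (e ∈ S' × P e)
meets-⊆ S⊆S' (e , e∈S , p) = e , S⊆S' e e∈S , p

module Missing {n : ℕ} (T : List (Cell n)) where

  meets? : (g : Cell n → Fin n) (r : Fin n) → Dec (Any (λ e → g e ≡ r) T)
  meets? g r = any? (λ e → g e Fin.≟ r) T

  missing : (Cell n → Fin n) → List (Fin n)
  missing g = filter (λ r → ¬? (meets? g r)) (allFin n)

  missing⁻ : ∀ {g r} → r ∈ missing g → ¬ Any (λ e → g e ≡ r) T
  missing⁻ {g} r∈ = proj₂ (∈-filter⁻ (λ r → ¬? (meets? g r)) {xs = allFin n} r∈)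

  met-or-missing : ∀ g r → Any (λ e → g e ≡ r) T ⊎ r ∈ missing g
  met-or-missing g r with meets? g r
  ... | yes met = inj₁ met
  ... | no unmet = inj₂ (∈-filter⁺ (λ r → ¬? (meets? g r)) (∈-allFin r) unmet)

  missing-unique : ∀ g → Unique (missing g)
  missing-unique g = Unique.filter⁺ (λ r → ¬? (meets? g r)) {allFin n} (Unique.allFin⁺ n)

  -- If T meets each line of kind g at most once and has n - d cells, T misses exactly d
  -- lines of kind g: the missed values and the values g takes on T partition Fin n.
  missing-length : ∀ g d → Unique T → InjectiveOn g T → length T + d ≡ n → length (missing g) ≡ d
  missing-length g d uT inj deficit = +-cancelʳ-≡ (length T) (length (missing g)) d (begin
      length (missing g) + length T             ≡⟨ cong (length (missing g) +_) (≡-sym (length-map g T)) ⟩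
      length (missing g) + length (map g T)     ≡⟨ ≡-sym (length-++ (missing g)) ⟩
      length (missing g ++ map g T)             ≡⟨ complete-length (missing g ++ map g T) partition-unique partition-complete ⟩
      n                                         ≡⟨ ≡-sym deficit ⟩
      length T + d                              ≡⟨ +-comm (length T) d ⟩
      d + length T                              ∎)
    where
      open ≡-Reasoning
      partition-unique : Unique (missing g ++ map g T)
      partition-unique = Unique.++⁺ (missing-unique g) (map-unique g T uT inj)
        (λ (r∈missing , r∈image) → let (e , e∈T , r≡ge) = ∈-map⁻ g r∈image
                                    in missing⁻ r∈missing (lose e∈T (≡-sym r≡ge)))
      partition-complete : ∀ r → r ∈ missing g ++ map g T
      partition-complete r with met-or-missing g r
      ... | inj₁ met = let (e , e∈T , ge≡r) = find met
                       in ∈-++⁺ʳ (missing g) (subst (_∈ map g T) ge≡r (∈-map⁺ g e∈T))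
      ... | inj₂ r∈missing = ∈-++⁺ˡ r∈missing

module UpperBound {n : ℕ} (L : Fin n → Fin n → Fin n) (latin : IsLatinSquare n L)
                  (T : List (Cell n)) (pt : IsPartialTransversal L T)
                  (d : ℕ) (deficit : length T + d ≡ n) where
  open Missing T
  open Pairing

  h f : ℕ
  h = ⌈ d /2⌉
  f = ⌊ d /2⌋

  R K S : List (Fin n)
  R = missing row
  K = missing col
  S = missing (sym L)

  injR : InjectiveOn row T
  injR = proj₁ (proj₂ pt)
  injK : InjectiveOn col T
  injK = proj₁ (proj₂ (proj₂ pt))
  injS : InjectiveOn (sym L) T
  injS = proj₂ (proj₂ (proj₂ pt))

  colOf : Fin n → Fin n → Fin n
  colOf r s = proj₁ (proj₁ latin r s)
  colOf-sym : ∀ r s → L r (colOf r s) ≡ s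
  colOf-sym r s = proj₁ (proj₂ (proj₁ latin r s))
  rowOf : Fin n → Fin n → Fin n
  rowOf c s = proj₁ (proj₂ latin c s)
  rowOf-sym : ∀ c s → L (rowOf c s) c ≡ s
  rowOf-sym c s = proj₁ (proj₂ (proj₂ latin c s))

  -- Fallback cells covering a single row/column r, or a single symbol s.
  diagonal : Fin n → Cell n
  diagonal r = r , r
  carrier : Fin n → Cell n
  carrier s = s , colOf s s

  -- Rows R₁ ⊔ R₂, columns K₁ ⊔ K₂, symbols S₁ ⊔ S₂ (|R₁| = |K₁| = |S₂| = h, the rest f),
  -- paired as R₁–K₁, R₂–S₁ and K₂–S₂.
  E₁ E₂ E₃ extra : List (Cell n)
  E₁ = zipCover _,_ diagonal diagonal (take h R) (take h K)
  E₂ = zipCover (λ r s → r , colOf r s) diagonal carrier (drop h R) (take f S)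
  E₃ = zipCover (λ c s → rowOf c s , c) diagonal carrier (drop h K) (drop f S)
  extra = E₁ ++ E₂ ++ E₃

  missing-d : ∀ g → InjectiveOn g T → length (missing g) ≡ d
  missing-d g inj = missing-length g d (proj₁ pt) inj deficit

  take≤ : ∀ k (xs : List (Fin n)) → length (take k xs) ≤ k
  take≤ k xs = subst (_≤ k) (≡-sym (length-take k xs)) (m⊓n≤m k (length xs))

  drop≡ : ∀ k (xs : List (Fin n)) → length xs ≡ d → length (drop k xs) ≡ d ∸ k
  drop≡ k xs len = trans (length-drop k xs) (cong (_∸ k) len)

  f+h : f + h ≡ d
  f+h = ⌊n/2⌋+⌈n/2⌉≡n d

  extra-length : length extra ≤ h + (f + h)
  extra-length = subst (_≤ h + (f + h))
    (≡-sym (trans (length-++ E₁) (cong (length E₁ +_) (length-++ E₂))))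
    (+-mono-≤ E₁≤ (+-mono-≤ E₂≤ E₃≤))
    where
      d∸h : d ∸ h ≡ f
      d∸h = trans (cong (_∸ h) (≡-sym f+h)) (m+n∸n≡m f h)
      d∸f : d ∸ f ≡ h
      d∸f = trans (cong (_∸ f) (≡-sym f+h)) (m+n∸m≡n f h)
      E₁≤ : length E₁ ≤ h
      E₁≤ = zipCover-length _,_ diagonal diagonal (take h R) (take h K) h (take≤ h R) (take≤ h K)
      E₂≤ : length E₂ ≤ f
      E₂≤ = zipCover-length (λ r s → r , colOf r s) diagonal carrier (drop h R) (take f S) f
        (≤-reflexive (trans (drop≡ h R (missing-d row injR)) d∸h)) (take≤ f S)
      E₃≤ : length E₃ ≤ h
      E₃≤ = zipCover-length (λ c s → rowOf c s , c) diagonal carrier (drop h K) (drop f S) h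
        (≤-trans (≤-reflexive (trans (drop≡ h K (missing-d col injK)) d∸h)) (⌊n/2⌋≤⌈n/2⌉ d))
        (≤-reflexive (trans (drop≡ f S (missing-d (sym L) injS)) d∸f))

  U : List (Cell n)
  U = extra ++ T

  in-T : ∀ {g : Cell n → Fin n} {r} → Any (λ e → g e ≡ r) T → ∃[ e ] (e ∈ U × g e ≡ r)
  in-T met = let (e , e∈T , ge≡r) = find met in e , ∈-++⁺ʳ extra e∈T , ge≡r
  in-E₁ : ∀ e → e ∈ E₁ → e ∈ U
  in-E₁ _ p = ∈-++⁺ˡ (∈-++⁺ˡ p)
  in-E₂ : ∀ e → e ∈ E₂ → e ∈ U
  in-E₂ _ p = ∈-++⁺ˡ (∈-++⁺ʳ E₁ (∈-++⁺ˡ p))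
  in-E₃ : ∀ e → e ∈ E₃ → e ∈ U
  in-E₃ _ p = ∈-++⁺ˡ (∈-++⁺ʳ E₁ (∈-++⁺ʳ E₂ p))

  split : ∀ k {xs : List (Fin n)} {r} → r ∈ xs → r ∈ take k xs ⊎ r ∈ drop k xs
  split k {xs} r∈ = ∈-++⁻ (take k xs) (subst (_ ∈_) (≡-sym (take++drop≡id k xs)) r∈)

  rows-met : MeetsAll U row
  rows-met r with met-or-missing row r
  ... | inj₁ met = in-T met
  ... | inj₂ r∈R with split h r∈R
  ... | inj₁ r∈ = meets-⊆ in-E₁ (zipCover-left _,_ diagonal diagonal (λ r e → row e ≡ r) (λ _ _ → refl) (λ _ → refl) (take h R) (take h K) r∈)
  ... | inj₂ r∈ = meets-⊆ in-E₂ (zipCover-left (λ r s → r , colOf r s) diagonal carrier (λ r e → row e ≡ r) (λ _ _ → refl) (λ _ → refl) (drop h R) (take f S) r∈)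

  cols-met : MeetsAll U col
  cols-met c with met-or-missing col c
  ... | inj₁ met = in-T met
  ... | inj₂ c∈K with split h c∈K
  ... | inj₁ c∈ = meets-⊆ in-E₁ (zipCover-right _,_ diagonal diagonal (λ c e → col e ≡ c) (λ _ _ → refl) (λ _ → refl) (take h R) (take h K) c∈)
  ... | inj₂ c∈ = meets-⊆ in-E₃ (zipCover-left (λ c s → rowOf c s , c) diagonal carrier (λ c e → col e ≡ c) (λ _ _ → refl) (λ _ → refl) (drop h K) (drop f S) c∈)

  symbols-met : MeetsAll U (sym L)
  symbols-met s with met-or-missing (sym L) s
  ... | inj₁ met = in-T met
  ... | inj₂ s∈S with split f s∈S
  ... | inj₁ s∈ = meets-⊆ in-E₂ (zipCover-right (λ r s → r , colOf r s) diagonal carrier (λ s e → sym L e ≡ s) colOf-sym (λ s → colOf-sym s s) (drop h R) (take f S) s∈)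
  ... | inj₂ s∈ = meets-⊆ in-E₃ (zipCover-right (λ c s → rowOf c s , c) diagonal carrier (λ s e → sym L e ≡ s) rowOf-sym (λ s → colOf-sym s s) (drop h K) (drop f S) s∈)

  cover : 2 ≤ n → ∃[ C ] (IsCover L C × T ⊆ C × length C ≡ n + h)
  cover 2≤n =
    let (C , uC , U'⊆C , lenC) = enlarge (allCells n) (allCells-unique n) U' (DecUnique.deduplicate-! _≟ᶜ_ U)
                                   (n + h) U'≤ (subst (n + h ≤_) (≡-sym (allCells-length n)) (room n h 2≤n h≤n))
        U⊆C = λ e e∈U → U'⊆C e (∈-deduplicate⁺ _≟ᶜ_ e∈U)
        in-C = λ {g} (met : MeetsAll U g) r → meets-⊆ U⊆C (met r)
    in C , (uC , in-C rows-met , in-C cols-met , in-C symbols-met) , (λ e e∈T → U⊆C e (∈-++⁺ʳ extra e∈T)) , lenC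
    where
      open DistinctLists (_≟ᶜ_ {n})
      open +-*-Solver
      U' : List (Cell n)
      U' = deduplicate _≟ᶜ_ U
      U'≤ : length U' ≤ n + h
      U'≤ = ≤-trans (length-deduplicate _≟ᶜ_ U) (subst (length U ≤_) sizes
              (subst (_≤ h + (f + h) + length T) (≡-sym (length-++ extra)) (+-monoˡ-≤ (length T) extra-length)))
        where
          sizes : h + (f + h) + length T ≡ n + h
          sizes = trans (solve 3 (λ h f t → (h :+ (f :+ h)) :+ t := (t :+ (f :+ h)) :+ h) refl h f (length T))
                        (cong (_+ h) (trans (cong (length T +_) f+h) deficit))
      h≤n : h ≤ n
      h≤n = ≤-trans (⌈n/2⌉≤n d) (subst (d ≤_) deficit (m≤n+m d (length T)))

-- A maximal partial transversal: no cell outside it lies on three missing lines,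
-- since such a cell could be added.
module Maximal {n : ℕ} (L : Fin n → Fin n → Fin n) (T : List (Cell n)) (maximal : IsMaximalPT L T) where
  open Missing T

  no-triple-missing : ∀ e → e ∉ T → ¬ (row e ∈ missing row × col e ∈ missing col × sym L e ∈ missing (sym L))
  no-triple-missing e e∉T (r∈ , c∈ , s∈) = proj₂ maximal e e∉T
    ( cons-unique e∉T uT
    , injectiveOn-∷ row injR (missing⁻ r∈)
    , injectiveOn-∷ col injK (missing⁻ c∈)
    , injectiveOn-∷ (sym L) injS (missing⁻ s∈))
    where
      uT : Unique T
      uT = proj₁ (proj₁ maximal)
      injR : InjectiveOn row T
      injR = proj₁ (proj₂ (proj₁ maximal))
      injK : InjectiveOn col T
      injK = proj₁ (proj₂ (proj₂ (proj₁ maximal)))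
      injS : InjectiveOn (sym L) T
      injS = proj₂ (proj₂ (proj₂ (proj₁ maximal)))

module LowerBound {n : ℕ} (L : Fin n → Fin n → Fin n) (T : List (Cell n)) (maximal : IsMaximalPT L T)
                  (d : ℕ) (deficit : length T + d ≡ n)
                  (C : List (Cell n)) (cover : IsCover L C) (T⊆C : T ⊆ C) where
  open Missing T
  open Maximal L T maximal
  open DistinctLists (_≟ᶜ_ {n}) using (unique-⊆-length)
  open import Data.List.Membership.DecPropositional (_≟ᶜ_ {n}) using (_∈?_)
  open import Data.List.Membership.DecPropositional (Fin._≟_ {n}) using () renaming (_∈?_ to _∈ᶠ?_)

  pt : IsPartialTransversal L T
  pt = proj₁ maximal

  outside-T? : Decidable (λ e → e ∉ T)
  outside-T? e = ¬? (e ∈? T)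

  X : List (Cell n)
  X = filter outside-T? C

  T+X≤C : length T + length X ≤ length C
  T+X≤C = subst (_≤ length C) (length-++ T)
    (unique-⊆-length (T ++ X) C (Unique.++⁺ (proj₁ pt) (Unique.filter⁺ outside-T? {C} (proj₁ cover)) disjoint) T++X⊆C)
    where
      disjoint : ∀ {e} → ¬ (e ∈ T × e ∈ X)
      disjoint (e∈T , e∈X) = proj₂ (∈-filter⁻ outside-T? {xs = C} e∈X) e∈T
      T++X⊆C : ∀ e → e ∈ T ++ X → e ∈ C
      T++X⊆C e e∈ = [ T⊆C e , (λ e∈X → proj₁ (∈-filter⁻ outside-T? {xs = C} e∈X)) ]′ (∈-++⁻ T e∈)

  hits : (Cell n → Fin n) → List (Cell n)
  hits g = filter (λ e → g e ∈ᶠ? missing g) X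

  -- Each of the d missing lines of kind g is met by C, necessarily by a cell of X.
  d≤hits : ∀ g → InjectiveOn g T → MeetsAll C g → d ≤ length (hits g)
  d≤hits g inj met = subst₂ _≤_ (missing-length g d (proj₁ pt) inj deficit) (length-map g (hits g))
    (DistinctLists.unique-⊆-length Fin._≟_ (missing g) (map g (hits g)) (missing-unique g) missing⊆image)
    where
      missing⊆image : ∀ r → r ∈ missing g → r ∈ map g (hits g)
      missing⊆image r r∈ =
        let (e , e∈C , ge≡r) = met r
            e∉T = λ e∈T → missing⁻ r∈ (lose e∈T ge≡r)
            e∈X = ∈-filter⁺ outside-T? e∈C e∉T
            e∈hits = ∈-filter⁺ (λ e → g e ∈ᶠ? missing g) e∈X (subst (_∈ missing g) (≡-sym ge≡r) r∈)
        in subst (_∈ map g (hits g)) ge≡r (∈-map⁺ g e∈hits)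

  bound : n + ⌈ d /2⌉ ≤ length C
  bound = subst (_≤ length C) (trans (≡-sym (+-assoc (length T) d ⌈ d /2⌉)) (cong (_+ ⌈ d /2⌉) deficit))
            (≤-trans (+-monoʳ-≤ (length T) (three-halves d (length X) 3d≤2X)) T+X≤C)
    where
      3d≤2X : d + d + d ≤ length X + length X
      3d≤2X = ≤-trans
        (+-mono-≤ (+-mono-≤ (d≤hits row (proj₁ (proj₂ pt)) (proj₁ (proj₂ cover)))
                            (d≤hits col (proj₁ (proj₂ (proj₂ pt))) (proj₁ (proj₂ (proj₂ cover)))))
                  (d≤hits (sym L) (proj₂ (proj₂ (proj₂ pt))) (proj₂ (proj₂ (proj₂ cover)))))
        (count-three _ _ _ X (λ e e∈X → no-triple-missing e (proj₂ (∈-filter⁻ outside-T? {xs = C} e∈X))))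

theorem2p1 : (n : ℕ) → 2 ≤ n → (L : Fin n → Fin n → Fin n) → IsLatinSquare n L →
    (d : ℕ) → (T : List (Cell n)) → IsPartialTransversal L T → length T + d ≡ n →
      (∃[ C ] (IsCover L C × T ⊆ C × length C ≡ n + ⌈ d /2⌉)) ×
      (IsMaximalPT L T → ∀ (C : List (Cell n)) → IsCover L C → T ⊆ C → n + ⌈ d /2⌉ ≤ length C)
theorem2p1 n 2≤n L latin d T pt deficit =
  UpperBound.cover L latin T pt d deficit 2≤n ,
  λ maximal C cover T⊆C → LowerBound.bound L T maximal d deficit C cover T⊆C
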